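{- Let $F$ be a formal group law over a ring $R$ such that the $n$-series $[n]_F(t)\in R[[t]]$ is not a zero-divisor for any $n>0$. Then the generalized $n$-series $s(n)=[n]_F(t)$ over $R[[t]]$ is Lucasian, i.e. $s(a+b)\equiv s(a)+s(b)\bmod s(a)s(b)$ for all $a,b\in\mathbf N$.
   Context: A generalized $n$-series (GNS) over a ring $D$ is a function $s\colon\mathbf N\to D$ with $s(0)=0$, $s(n)$ a non-zero-divisor for $n>0$, and $s(n-k)\mid s(n)-s(k)$ for all $n>k>0$. Under the stated hypothesis, $n\mapsto[n]_F(t)$ is a GNS over $R[[t]]$. -}

module Defs where

open import Level using (_⊔_)
open import Algebra.Bundles using (CommutativeRing)
open import Data.Nat as ℕ using (ℕ; zero; suc; _∸_; _≡ᵇ_)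
open import Data.Bool using (Bool; true; false; _∧_; if_then_else_)
open import Data.Fin as Fin using (Fin)
open import Data.Vec using (Vec; []; _∷_; zipWith; tabulate; foldr′)
open import Data.Product using (Σ)
open import Relation.Nullary.Decidable using (⌊_⌋)

-- Formal power series in k variables over a commutative ring R:
-- a series is its coefficient function on exponent vectors e ∈ ℕ^k
-- (the coefficient of x₀^{e₀} ⋯ x_{k-1}^{e_{k-1}}).
module _ {c ℓ} (R : CommutativeRing c ℓ) where
  open CommutativeRing R

  PS : ℕ → Set c
  PS k = Vec ℕ k → Carrier

  infix 4 _≈ₚ_
  _≈ₚ_ : ∀ {k} → PS k → PS k → Set ℓ
  p ≈ₚ q = ∀ e → p e ≈ q e

  sumTo : ℕ → (ℕ → Carrier) → Carrier
  sumTo zero    f = f 0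
  sumTo (suc n) f = sumTo n f + f (suc n)

  sumBelow : ∀ {k} → Vec ℕ k → (Vec ℕ k → Carrier) → Carrier
  sumBelow []      f = f []
  sumBelow (n ∷ e) f = sumTo n (λ m → sumBelow e (λ d → f (m ∷ d)))

  eqVec : ∀ {k} → Vec ℕ k → Vec ℕ k → Bool
  eqVec []      []      = true
  eqVec (m ∷ d) (n ∷ e) = (m ≡ᵇ n) ∧ eqVec d e

  zeroVec : ∀ k → Vec ℕ k
  zeroVec k = tabulate (λ _ → 0)

  degree : ∀ {k} → Vec ℕ k → ℕ
  degree = foldr′ ℕ._+_ 0

  0ₚ : ∀ {k} → PS k
  0ₚ _ = 0#

  1ₚ : ∀ {k} → PS k
  1ₚ {k} e = if eqVec e (zeroVec k) then 1# else 0#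

  var : ∀ {k} → Fin k → PS k
  var {k} i e =
    if eqVec e (tabulate (λ j → if ⌊ j Fin.≟ i ⌋ then 1 else 0)) then 1# else 0#

  infixl 6 _+ₚ_
  infixl 7 _*ₚ_
  _+ₚ_ : ∀ {k} → PS k → PS k → PS k
  (p +ₚ q) e = p e + q e

  _*ₚ_ : ∀ {k} → PS k → PS k → PS k
  (p *ₚ q) e = sumBelow e (λ d → p d * q (zipWith _∸_ e d))

  powₚ : ∀ {k} → PS k → ℕ → PS k
  powₚ p zero    = 1ₚ
  powₚ p (suc n) = p *ₚ powₚ p n

  -- Substitution F(g, h) of series g, h in k variables with zero constant
  -- term into a two-variable series F: the coefficient at e only receives
  -- contributions from F's monomials x^i y^j with i, j ≤ degree e.
  subst₂ : ∀ {k} → PS 2 → PS k → PS k → PS k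
  subst₂ F g h e =
    sumTo (degree e) (λ i → sumTo (degree e) (λ j →
      F (i ∷ j ∷ []) * (powₚ g i *ₚ powₚ h j) e))

  record IsFGL (F : PS 2) : Set ℓ where
    field
      identityˡ : subst₂ F (var Fin.zero) 0ₚ ≈ₚ var {1} Fin.zero
      identityʳ : subst₂ F 0ₚ (var Fin.zero) ≈ₚ var {1} Fin.zero
      comm      : subst₂ {2} F (var (Fin.suc Fin.zero)) (var Fin.zero) ≈ₚ F
      assoc     : subst₂ {3} F (subst₂ F (var Fin.zero) (var (Fin.suc Fin.zero)))
                           (var (Fin.suc (Fin.suc Fin.zero)))
                  ≈ₚ subst₂ F (var Fin.zero)
                       (subst₂ F (var (Fin.suc Fin.zero)) (var (Fin.suc (Fin.suc Fin.zero))))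

  nSeries : PS 2 → ℕ → PS 1
  nSeries F zero    = 0ₚ
  nSeries F (suc n) = subst₂ F (nSeries F n) (var Fin.zero)

  NonZeroDivisor : PS 1 → Set (c ⊔ ℓ)
  NonZeroDivisor s = ∀ (g : PS 1) → s *ₚ g ≈ₚ 0ₚ → g ≈ₚ 0ₚ

  CongMod : PS 1 → PS 1 → PS 1 → Set (c ⊔ ℓ)
  CongMod x y m = Σ (PS 1) (λ q → x ≈ₚ y +ₚ m *ₚ q)

-- By associativity, [a + b]_F = F([a]_F, [b]_F).  The identities F(x, 0) = x and F(0, y) = y fix the
-- coefficients of F on the two axes, so F(x, y) = x + y + x y G(x, y) with G(x, y) = ∑ F_{i+1,j+1} x^i y^j,
-- and [a + b] − [a] − [b] = [a][b] G([a], [b]).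
-- The axioms of F are identities between series in the variables x, y, z; they are transported to
-- arbitrary series without constant term by evaluation R[[x₁, …, x_k]] → R[[t]] at such series, which is
-- multiplicative and commutes with substitution into F.  Every coefficient of every series involved is a
-- finite sum, because a series without constant term raised to the i-th power vanishes below degree i.
module Submission where

open import Algebra.Bundles using (CommutativeRing)
import Algebra.Properties.CommutativeSemigroup as CommutativeSemigroupProperties
open import Data.Bool using (if_then_else_)
open import Data.Empty using (⊥-elim)
open import Data.Fin as Fin using (Fin) renaming (zero to fzero; suc to fsuc)
open import Data.Nat as ℕ using (ℕ; zero; suc; _∸_; _≤_; _<_; z≤n; s≤s; _<?_; _≤?_)
import Data.Nat.Properties as ℕₚ
open import Data.Product using (_,_)
open import Data.Sum using (inj₁; inj₂)
open import Data.Vec using (Vec; []; _∷_; zipWith)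
open import Data.Vec.Properties using (tabulate-cong)
open import Data.Vec.Relation.Binary.Pointwise.Inductive using (Pointwise; []; _∷_)
open import Data.Vec.Relation.Unary.All using (All; []; _∷_)
open import Relation.Binary.Bundles using (Setoid)
open import Relation.Binary.PropositionalEquality as ≡ using (_≡_; _≢_)
open import Relation.Nullary using (Dec; yes; no)
open import Relation.Nullary.Decidable using (⌊_⌋)
import Relation.Binary.Reasoning.Setoid as SetoidReasoning

open import Defs

module _ {c ℓ} (R : CommutativeRing c ℓ) where

  open CommutativeRing R hiding (zero)
  module ≈-Reasoning = SetoidReasoning setoid
  open CommutativeSemigroupProperties +-commutativeSemigroup using () renaming (interchange to +-interchange)
  open CommutativeSemigroupProperties ℕₚ.+-commutativeSemigroup using () renaming (interchange to ℕ-interchange)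

  -- Finite sums

  ∑ : ℕ → (ℕ → Carrier) → Carrier
  ∑ = sumTo R

  syntax ∑ n (λ i → x) = ∑[ i ≤ n ] x

  ∑-cong : ∀ n {f g : ℕ → Carrier} → (∀ i → i ≤ n → f i ≈ g i) → ∑ n f ≈ ∑ n g
  ∑-cong zero    f≈g = f≈g 0 z≤n
  ∑-cong (suc n) f≈g = +-cong (∑-cong n (λ i i≤n → f≈g i (ℕₚ.m≤n⇒m≤1+n i≤n))) (f≈g (suc n) ℕₚ.≤-refl)

  ∑-≈0 : ∀ n {f : ℕ → Carrier} → (∀ i → i ≤ n → f i ≈ 0#) → ∑ n f ≈ 0#
  ∑-≈0 zero    f≈0 = f≈0 0 z≤n
  ∑-≈0 (suc n) {f} f≈0 = begin
    ∑ n f + f (suc n) ≈⟨ +-cong (∑-≈0 n (λ i i≤n → f≈0 i (ℕₚ.m≤n⇒m≤1+n i≤n))) (f≈0 (suc n) ℕₚ.≤-refl) ⟩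
    0# + 0#           ≈⟨ +-identityʳ 0# ⟩
    0#                ∎
    where open ≈-Reasoning

  ∑-distrib-+ : ∀ n (f g : ℕ → Carrier) → ∑[ i ≤ n ] (f i + g i) ≈ ∑ n f + ∑ n g
  ∑-distrib-+ zero    f g = refl
  ∑-distrib-+ (suc n) f g = trans (+-congʳ (∑-distrib-+ n f g)) (+-interchange _ _ _ _)

  *-distribˡ-∑ : ∀ n a (f : ℕ → Carrier) → a * ∑ n f ≈ ∑[ i ≤ n ] (a * f i)
  *-distribˡ-∑ zero    a f = refl
  *-distribˡ-∑ (suc n) a f = trans (distribˡ _ _ _) (+-congʳ (*-distribˡ-∑ n a f))

  *-distribʳ-∑ : ∀ n a (f : ℕ → Carrier) → ∑ n f * a ≈ ∑[ i ≤ n ] (f i * a)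
  *-distribʳ-∑ zero    a f = refl
  *-distribʳ-∑ (suc n) a f = trans (distribʳ _ _ _) (+-congʳ (*-distribʳ-∑ n a f))

  ∑-head : ∀ n (f : ℕ → Carrier) → ∑ (suc n) f ≈ f 0 + ∑[ i ≤ n ] f (suc i)
  ∑-head zero    f = refl
  ∑-head (suc n) f = trans (+-congʳ (∑-head n f)) (+-assoc _ _ _)

  ∑-truncate : ∀ {m} n {f : ℕ → Carrier} → m ≤ n → (∀ i → m < i → i ≤ n → f i ≈ 0#) → ∑ n f ≈ ∑ m f
  ∑-truncate zero    z≤n   _   = refl
  ∑-truncate {m} (suc n) {f} m≤1+n f≈0 with ℕₚ.m≤n⇒m<n∨m≡n m≤1+n
  ... | inj₂ ≡.refl = refl
  ... | inj₁ m<1+n  = begin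
    ∑ n f + f (suc n) ≈⟨ +-cong (∑-truncate n (ℕₚ.m<1+n⇒m≤n m<1+n) (λ i m<i i≤n → f≈0 i m<i (ℕₚ.m≤n⇒m≤1+n i≤n)))
                        (f≈0 (suc n) m<1+n ℕₚ.≤-refl) ⟩
    ∑ m f + 0#        ≈⟨ +-identityʳ _ ⟩
    ∑ m f             ∎
    where open ≈-Reasoning

  ∑-single : ∀ n j {f : ℕ → Carrier} → j ≤ n → (∀ i → i ≤ n → i ≢ j → f i ≈ 0#) → ∑ n f ≈ f j
  ∑-single n zero    z≤n  f≈0 = ∑-truncate n z≤n (λ i 0<i i≤n → f≈0 i i≤n (ℕₚ.>⇒≢ 0<i))
  ∑-single n (suc j) {f} j<n f≈0 = begin
    ∑ n f             ≈⟨ ∑-truncate n j<n (λ i j<i i≤n → f≈0 i i≤n (ℕₚ.>⇒≢ j<i)) ⟩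
    ∑ j f + f (suc j) ≈⟨ +-congʳ (∑-≈0 j (λ i i≤j →
                           f≈0 i (ℕₚ.≤-trans (ℕₚ.m≤n⇒m≤1+n i≤j) j<n) (ℕₚ.<⇒≢ (s≤s i≤j)))) ⟩
    0# + f (suc j)    ≈⟨ +-identityˡ _ ⟩
    f (suc j)         ∎
    where open ≈-Reasoning

  ∑-comm : ∀ n m (g : ℕ → ℕ → Carrier) → ∑[ i ≤ n ] ∑ m (g i) ≈ ∑[ j ≤ m ] ∑[ i ≤ n ] g i j
  ∑-comm zero    m g = refl
  ∑-comm (suc n) m g = trans (+-congʳ (∑-comm n m g)) (sym (∑-distrib-+ m _ _))

  ∑-reverse : ∀ n (f : ℕ → Carrier) → ∑ n f ≈ ∑[ i ≤ n ] f (n ∸ i)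
  ∑-reverse zero    f = refl
  ∑-reverse (suc n) f = begin
    ∑ n f + f (suc n)                  ≈⟨ +-comm _ _ ⟩
    f (suc n) + ∑ n f                  ≈⟨ +-congˡ (∑-reverse n f) ⟩
    f (suc n) + ∑[ i ≤ n ] f (n ∸ i)   ≈⟨ ∑-head n _ ⟨
    ∑[ i ≤ suc n ] f (suc n ∸ i)       ∎
    where open ≈-Reasoning

  ∑-antidiagonals : ∀ n (g : ℕ → ℕ → Carrier) →
    ∑[ m ≤ n ] ∑[ i ≤ m ] g i (m ∸ i) ≈ ∑[ i ≤ n ] ∑ (n ∸ i) (g i)
  ∑-antidiagonals zero    g = refl
  ∑-antidiagonals (suc n) g = begin
    ∑[ m ≤ n ] ∑[ i ≤ m ] g i (m ∸ i) + ∑[ i ≤ suc n ] g i (suc n ∸ i)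
      ≈⟨ +-congʳ (∑-antidiagonals n g) ⟩
    T + (∑[ i ≤ n ] g i (suc n ∸ i) + g (suc n) (suc n ∸ suc n))
      ≈⟨ +-congˡ (+-cong (∑-cong n (λ i i≤n → reflexive (≡.cong (g i) (ℕₚ.+-∸-assoc 1 i≤n))))
                         (reflexive (≡.cong (g (suc n)) (ℕₚ.n∸n≡0 n)))) ⟩
    T + (∑[ i ≤ n ] g i (suc (n ∸ i)) + g (suc n) 0)
      ≈⟨ +-assoc _ _ _ ⟨
    (T + ∑[ i ≤ n ] g i (suc (n ∸ i))) + g (suc n) 0
      ≈⟨ +-congʳ (∑-distrib-+ n _ _) ⟨
    ∑[ i ≤ n ] ∑ (suc (n ∸ i)) (g i) + g (suc n) 0
      ≈⟨ +-cong (∑-cong n (λ i i≤n → reflexive (≡.cong (λ m → ∑ m (g i)) (ℕₚ.+-∸-assoc 1 i≤n))))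
                (reflexive (≡.cong (λ m → ∑ m (g (suc n))) (ℕₚ.n∸n≡0 n))) ⟨
    ∑[ i ≤ suc n ] ∑ (suc n ∸ i) (g i) ∎
    where
    open ≈-Reasoning
    T = ∑[ i ≤ n ] ∑ (n ∸ i) (g i)

  ∑²-truncate : ∀ {m} n (g : ℕ → ℕ → Carrier) → m ≤ n → (∀ i j → m < i ℕ.+ j → g i j ≈ 0#) →
    ∑[ i ≤ n ] ∑ n (g i) ≈ ∑[ i ≤ m ] ∑ m (g i)
  ∑²-truncate {m} n g m≤n g≈0 = begin
    ∑[ i ≤ n ] ∑ n (g i) ≈⟨ ∑-cong n (λ i _ → ∑-truncate n m≤n (λ j m<j _ →
                              g≈0 i j (ℕₚ.<-≤-trans m<j (ℕₚ.m≤n+m j i)))) ⟩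
    ∑[ i ≤ n ] ∑ m (g i) ≈⟨ ∑-truncate n m≤n (λ i m<i _ → ∑-≈0 m (λ j _ →
                              g≈0 i j (ℕₚ.<-≤-trans m<i (ℕₚ.m≤m+n i j)))) ⟩
    ∑[ i ≤ m ] ∑ m (g i) ∎
    where open ≈-Reasoning

  ∑²-split : ∀ n (g : ℕ → ℕ → Carrier) →
    ∑[ i ≤ suc n ] ∑ (suc n) (g i) ≈
      ((g 0 0 + ∑[ j ≤ n ] g 0 (suc j)) + ∑[ i ≤ n ] g (suc i) 0) + ∑[ i ≤ n ] ∑[ j ≤ n ] g (suc i) (suc j)
  ∑²-split n g = begin
    ∑[ i ≤ suc n ] ∑ (suc n) (g i)
      ≈⟨ ∑-head n _ ⟩
    ∑ (suc n) (g 0) + ∑[ i ≤ n ] ∑ (suc n) (g (suc i))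
      ≈⟨ +-cong (∑-head n (g 0)) (∑-cong n (λ i _ → ∑-head n (g (suc i)))) ⟩
    (g 0 0 + ∑[ j ≤ n ] g 0 (suc j)) + ∑[ i ≤ n ] (g (suc i) 0 + ∑[ j ≤ n ] g (suc i) (suc j))
      ≈⟨ +-congˡ (∑-distrib-+ n _ _) ⟩
    (g 0 0 + ∑[ j ≤ n ] g 0 (suc j)) + (∑[ i ≤ n ] g (suc i) 0 + ∑[ i ≤ n ] ∑[ j ≤ n ] g (suc i) (suc j))
      ≈⟨ +-assoc _ _ _ ⟨
    ((g 0 0 + ∑[ j ≤ n ] g 0 (suc j)) + ∑[ i ≤ n ] g (suc i) 0) + ∑[ i ≤ n ] ∑[ j ≤ n ] g (suc i) (suc j) ∎
    where open ≈-Reasoning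

  -- Power series

  infix  4 _≋_
  infixl 6 _⊞_
  infixl 7 _⊠_ _·_
  infixr 8 _^_

  _≋_ : ∀ {k} → PS R k → PS R k → Set ℓ
  _≋_ = _≈ₚ_ R

  _⊞_ : ∀ {k} → PS R k → PS R k → PS R k
  _⊞_ = _+ₚ_ R

  _⊠_ : ∀ {k} → PS R k → PS R k → PS R k
  _⊠_ = _*ₚ_ R

  _^_ : ∀ {k} → PS R k → ℕ → PS R k
  _^_ = powₚ R

  _·_ : ∀ {k} → Carrier → PS R k → PS R k
  (a · X) e = a * X e

  𝟘 𝟙 : ∀ {k} → PS R k
  𝟘 = 0ₚ R
  𝟙 = 1ₚ R

  ∑ₚ : ∀ {k} → ℕ → (ℕ → PS R k) → PS R k
  ∑ₚ n F e = ∑[ i ≤ n ] F i e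

  syntax ∑ₚ n (λ i → X) = ∑ₚ[ i ≤ n ] X

  coeff : PS R 1 → ℕ → Carrier
  coeff X n = X (n ∷ [])

  ≋-refl : ∀ {k} {X : PS R k} → X ≋ X
  ≋-refl e = refl

  ≋-sym : ∀ {k} {X Y : PS R k} → X ≋ Y → Y ≋ X
  ≋-sym X≋Y e = sym (X≋Y e)

  ≋-trans : ∀ {k} {X Y Z : PS R k} → X ≋ Y → Y ≋ Z → X ≋ Z
  ≋-trans X≋Y Y≋Z e = trans (X≋Y e) (Y≋Z e)

  ≋-setoid : ℕ → Setoid c ℓ
  ≋-setoid k = record
    { Carrier       = PS R k
    ; _≈_           = _≋_
    ; isEquivalence = record { refl = ≋-refl ; sym = ≋-sym ; trans = ≋-trans }
    }

  module ≋-Reasoning {k} = SetoidReasoning (≋-setoid k)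

  ≡⇒≋ : ∀ {k} {X Y : PS R k} → X ≡ Y → X ≋ Y
  ≡⇒≋ ≡.refl = ≋-refl

  sumBelow-cong : ∀ {k} (e : Vec ℕ k) {f g : Vec ℕ k → Carrier} →
    (∀ d → Pointwise _≤_ d e → f d ≈ g d) → sumBelow R e f ≈ sumBelow R e g
  sumBelow-cong []      f≈g = f≈g [] []
  sumBelow-cong (n ∷ e) f≈g = ∑-cong n (λ m m≤n → sumBelow-cong e (λ d d≤e → f≈g (m ∷ d) (m≤n ∷ d≤e)))

  sumBelow-≈0 : ∀ {k} (e : Vec ℕ k) {f : Vec ℕ k → Carrier} →
    (∀ d → Pointwise _≤_ d e → f d ≈ 0#) → sumBelow R e f ≈ 0#
  sumBelow-≈0 []      f≈0 = f≈0 [] []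
  sumBelow-≈0 (n ∷ e) f≈0 = ∑-≈0 n (λ m m≤n → sumBelow-≈0 e (λ d d≤e → f≈0 (m ∷ d) (m≤n ∷ d≤e)))

  ⊠-cong : ∀ {k} {X X′ Y Y′ : PS R k} → X ≋ X′ → Y ≋ Y′ → X ⊠ Y ≋ X′ ⊠ Y′
  ⊠-cong X≋X′ Y≋Y′ e = sumBelow-cong e (λ d _ → *-cong (X≋X′ d) (Y≋Y′ (zipWith _∸_ e d)))

  ⊠-zeroˡ : ∀ {k} (Y : PS R k) → 𝟘 ⊠ Y ≋ 𝟘
  ⊠-zeroˡ Y e = sumBelow-≈0 e (λ d _ → zeroˡ _)

  ⊠-zeroʳ : ∀ {k} (X : PS R k) → X ⊠ 𝟘 ≋ 𝟘
  ⊠-zeroʳ X e = sumBelow-≈0 e (λ d _ → zeroʳ _)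

  ·-cong : ∀ {k} a {X Y : PS R k} → X ≋ Y → a · X ≋ a · Y
  ·-cong a X≋Y e = *-congˡ (X≋Y e)

  ∑ₚ-cong : ∀ {k} n {F G : ℕ → PS R k} → (∀ i → i ≤ n → F i ≋ G i) → ∑ₚ n F ≋ ∑ₚ n G
  ∑ₚ-cong n F≋G e = ∑-cong n (λ i i≤n → F≋G i i≤n e)

  ^-cong : ∀ {k} {A B : PS R k} → A ≋ B → ∀ i → A ^ i ≋ B ^ i
  ^-cong A≋B zero    = ≋-refl
  ^-cong A≋B (suc i) = ⊠-cong A≋B (^-cong A≋B i)

  coeff-𝟙 : ∀ n → n ≢ 0 → coeff 𝟙 n ≈ 0#
  coeff-𝟙 zero    n≢0 = ⊥-elim (n≢0 ≡.refl)
  coeff-𝟙 (suc n) _   = refl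

  coeff-⊠-cong : ∀ n {X X′ Y Y′ : PS R 1} →
    (∀ d → d ≤ n → coeff X d ≈ coeff X′ d) → (∀ d → d ≤ n → coeff Y d ≈ coeff Y′ d) →
    coeff (X ⊠ Y) n ≈ coeff (X′ ⊠ Y′) n
  coeff-⊠-cong n X≈X′ Y≈Y′ = ∑-cong n (λ m m≤n → *-cong (X≈X′ m m≤n) (Y≈Y′ (n ∸ m) (ℕₚ.m∸n≤m n m)))

  ⊠-comm : (X Y : PS R 1) → X ⊠ Y ≋ Y ⊠ X
  ⊠-comm X Y (n ∷ []) = begin
    ∑[ m ≤ n ] (coeff X m * coeff Y (n ∸ m))             ≈⟨ ∑-reverse n _ ⟩
    ∑[ m ≤ n ] (coeff X (n ∸ m) * coeff Y (n ∸ (n ∸ m))) ≈⟨ ∑-cong n (λ m m≤n → trans (*-comm _ _)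
                                                              (*-congʳ (reflexive (≡.cong (coeff Y) (ℕₚ.m∸[m∸n]≡n m≤n))))) ⟩
    ∑[ m ≤ n ] (coeff Y m * coeff X (n ∸ m))             ∎
    where open ≈-Reasoning

  ⊠-assoc : (X Y Z : PS R 1) → (X ⊠ Y) ⊠ Z ≋ X ⊠ (Y ⊠ Z)
  ⊠-assoc X Y Z (n ∷ []) = begin
    ∑[ m ≤ n ] (∑[ i ≤ m ] (coeff X i * coeff Y (m ∸ i)) * coeff Z (n ∸ m))
      ≈⟨ ∑-cong n (λ m _ → trans (*-distribʳ-∑ m _ _) (∑-cong m (λ i i≤m →
           trans (*-assoc _ _ _)
                 (*-congˡ (*-congˡ (reflexive (≡.cong (λ l → coeff Z (n ∸ l)) (≡.sym (ℕₚ.m+[n∸m]≡n i≤m))))))))) ⟩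
    ∑[ m ≤ n ] ∑[ i ≤ m ] g i (m ∸ i)
      ≈⟨ ∑-antidiagonals n g ⟩
    ∑[ i ≤ n ] ∑ (n ∸ i) (g i)
      ≈⟨ ∑-cong n (λ i _ → trans (*-distribˡ-∑ (n ∸ i) _ _)
           (∑-cong (n ∸ i) (λ j _ → *-congˡ (*-congˡ (reflexive (≡.cong (coeff Z) (ℕₚ.∸-+-assoc n i j))))))) ⟨
    ∑[ i ≤ n ] (coeff X i * ∑[ j ≤ n ∸ i ] (coeff Y j * coeff Z ((n ∸ i) ∸ j))) ∎
    where
    open ≈-Reasoning
    g : ℕ → ℕ → Carrier
    g i j = coeff X i * (coeff Y j * coeff Z (n ∸ (i ℕ.+ j)))

  ⊠-identityˡ : (X : PS R 1) → 𝟙 ⊠ X ≋ X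
  ⊠-identityˡ X (n ∷ []) =
    trans (∑-single n 0 z≤n (λ i _ i≢0 → trans (*-congʳ (coeff-𝟙 i i≢0)) (zeroˡ _))) (*-identityˡ _)

  ⊠-identityʳ : (X : PS R 1) → X ⊠ 𝟙 ≋ X
  ⊠-identityʳ X = ≋-trans (⊠-comm X 𝟙) (⊠-identityˡ X)

  ⊠-distribʳ-⊞ : (X Y Z : PS R 1) → (X ⊞ Y) ⊠ Z ≋ X ⊠ Z ⊞ Y ⊠ Z
  ⊠-distribʳ-⊞ X Y Z (n ∷ []) = trans (∑-cong n (λ m _ → distribʳ _ _ _)) (∑-distrib-+ n _ _)

  ·-⊠ : ∀ a (X Y : PS R 1) → (a · X) ⊠ Y ≋ a · (X ⊠ Y)
  ·-⊠ a X Y (n ∷ []) = trans (∑-cong n (λ m _ → *-assoc _ _ _)) (sym (*-distribˡ-∑ n a _))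

  ⊠-· : ∀ a (X Y : PS R 1) → X ⊠ (a · Y) ≋ a · (X ⊠ Y)
  ⊠-· a X Y = ≋-trans (⊠-comm X (a · Y)) (≋-trans (·-⊠ a Y X) (·-cong a (⊠-comm Y X)))

  ⊠-distribʳ-∑ₚ : ∀ n (F : ℕ → PS R 1) (Y : PS R 1) → ∑ₚ n F ⊠ Y ≋ ∑ₚ[ i ≤ n ] (F i ⊠ Y)
  ⊠-distribʳ-∑ₚ N F Y (n ∷ []) = trans (∑-cong n (λ m _ → *-distribʳ-∑ N _ _)) (∑-comm n N _)

  ⊠-distribˡ-∑ₚ : ∀ n (F : ℕ → PS R 1) (X : PS R 1) → X ⊠ ∑ₚ n F ≋ ∑ₚ[ i ≤ n ] (X ⊠ F i)
  ⊠-distribˡ-∑ₚ N F X = ≋-trans (⊠-comm X (∑ₚ N F))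
    (≋-trans (⊠-distribʳ-∑ₚ N F X) (∑ₚ-cong N (λ i _ → ⊠-comm (F i) X)))

  ⊠-interchange : (W X Y Z : PS R 1) → (W ⊠ X) ⊠ (Y ⊠ Z) ≋ (W ⊠ Y) ⊠ (X ⊠ Z)
  ⊠-interchange W X Y Z = begin
    (W ⊠ X) ⊠ (Y ⊠ Z) ≈⟨ ⊠-assoc W X (Y ⊠ Z) ⟩
    W ⊠ (X ⊠ (Y ⊠ Z)) ≈⟨ ⊠-cong ≋-refl (⊠-assoc X Y Z) ⟨
    W ⊠ ((X ⊠ Y) ⊠ Z) ≈⟨ ⊠-cong ≋-refl (⊠-cong (⊠-comm X Y) (≋-refl {X = Z})) ⟩
    W ⊠ ((Y ⊠ X) ⊠ Z) ≈⟨ ⊠-cong ≋-refl (⊠-assoc Y X Z) ⟩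
    W ⊠ (Y ⊠ (X ⊠ Z)) ≈⟨ ⊠-assoc W Y (X ⊠ Z) ⟨
    (W ⊠ Y) ⊠ (X ⊠ Z) ∎
    where open ≋-Reasoning

  ^-+ : (A : PS R 1) → ∀ i j → A ^ (i ℕ.+ j) ≋ A ^ i ⊠ A ^ j
  ^-+ A zero    j = ≋-sym (⊠-identityˡ (A ^ j))
  ^-+ A (suc i) j = ≋-trans (⊠-cong ≋-refl (^-+ A i j)) (≋-sym (⊠-assoc A (A ^ i) (A ^ j)))

  -- Order

  infix 4 _hasOrder≥_
  _hasOrder≥_ : ∀ {k} → PS R k → ℕ → Set ℓ
  X hasOrder≥ a = ∀ e → degree R e < a → X e ≈ 0#

  NoConstantTerm : ∀ {k} → PS R k → Set ℓ
  NoConstantTerm X = X hasOrder≥ 1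

  degree-split : ∀ {k} {d e : Vec ℕ k} → Pointwise _≤_ d e →
    degree R d ℕ.+ degree R (zipWith _∸_ e d) ≡ degree R e
  degree-split []                              = ≡.refl
  degree-split {d = m ∷ d} {n ∷ e} (m≤n ∷ d≤e) =
    ≡.trans (ℕ-interchange m (degree R d) (n ∸ m) (degree R (zipWith _∸_ e d)))
            (≡.cong₂ ℕ._+_ (ℕₚ.m+[n∸m]≡n m≤n) (degree-split d≤e))

  ⊠-hasOrder≥ : ∀ {k} {X Y : PS R k} {a b} → X hasOrder≥ a → Y hasOrder≥ b → X ⊠ Y hasOrder≥ a ℕ.+ b
  ⊠-hasOrder≥ {X = X} {Y} {a} {b} Xa Yb e deg<a+b = sumBelow-≈0 e term≈0
    where
    term≈0 : ∀ d → Pointwise _≤_ d e → X d * Y (zipWith _∸_ e d) ≈ 0#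
    term≈0 d d≤e with degree R d <? a
    ... | yes deg<a = trans (*-congʳ (Xa d deg<a)) (zeroˡ _)
    ... | no  deg≮a = trans (*-congˡ (Yb _ (ℕₚ.+-cancelˡ-< a _ _ a+deg<a+b))) (zeroʳ _)
      where
      open ℕₚ.≤-Reasoning
      a+deg<a+b : a ℕ.+ degree R (zipWith _∸_ e d) < a ℕ.+ b
      a+deg<a+b = begin-strict
        a ℕ.+ degree R (zipWith _∸_ e d)          ≤⟨ ℕₚ.+-monoˡ-≤ _ (ℕₚ.≮⇒≥ deg≮a) ⟩
        degree R d ℕ.+ degree R (zipWith _∸_ e d) ≡⟨ degree-split d≤e ⟩
        degree R e                                <⟨ deg<a+b ⟩
        a ℕ.+ b                                   ∎

  𝟘-noConstantTerm : ∀ {k} → NoConstantTerm {k} 𝟘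
  𝟘-noConstantTerm _ _ = refl

  ⊠-hasOrder≥ʳ : ∀ {k} {X Y : PS R k} {b} → Y hasOrder≥ b → X ⊠ Y hasOrder≥ b
  ⊠-hasOrder≥ʳ = ⊠-hasOrder≥ {a = 0} (λ _ ())

  ^-hasOrder≥ : ∀ {k} {A : PS R k} → NoConstantTerm A → ∀ i → A ^ i hasOrder≥ i
  ^-hasOrder≥ A₀ zero    e ()
  ^-hasOrder≥ A₀ (suc i) = ⊠-hasOrder≥ A₀ (^-hasOrder≥ A₀ i)

  coeff-hasOrder≥ : ∀ {X : PS R 1} {a} → X hasOrder≥ a → ∀ {n} → n < a → coeff X n ≈ 0#
  coeff-hasOrder≥ {a = a} Xa {n} n<a = Xa (n ∷ []) (≡.subst (ℕ._< a) (≡.sym (ℕₚ.+-identityʳ n)) n<a)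

  -- Evaluation at series without constant term

  slice : ∀ {k} → PS R (suc k) → ℕ → PS R k
  slice P m e = P (m ∷ e)

  slice-var-suc : ∀ {k} (i : Fin k) → slice (var R (fsuc i)) 0 ≋ var R i
  slice-var-suc i e = reflexive (≡.cong (λ v → if eqVec R e v then 1# else 0#)
    (tabulate-cong (λ j → ≡.cong (λ b → if b then 1 else 0) (does-suc≟suc j))))
    where
    -- The left side only reduces once j ≟ i is a constructor.
    does-suc≟suc : ∀ j → ⌊ fsuc j Fin.≟ fsuc i ⌋ ≡ ⌊ j Fin.≟ i ⌋
    does-suc≟suc j with j Fin.≟ i
    ... | yes _ = ≡.refl
    ... | no  _ = ≡.refl

  var-noConstantTerm : ∀ {k} (i : Fin k) → NoConstantTerm (var R i)
  var-noConstantTerm i        (suc m ∷ e) (s≤s ())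
  var-noConstantTerm fzero    (zero ∷ e)  _     = refl
  var-noConstantTerm (fsuc i) (zero ∷ e)  deg<1 = trans (slice-var-suc i e) (var-noConstantTerm i e deg<1)

  -- eval (u ∷ us) P is ∑ₘ (slice P m)(us) u^m; cutting the sum at m = n for the n-th coefficient
  -- loses nothing as long as u has no constant term.
  eval : ∀ {k} → Vec (PS R 1) k → PS R k → PS R 1
  eval []       P          = P [] · 𝟙
  eval (u ∷ us) P (n ∷ []) = ∑[ m ≤ n ] coeff (eval us (slice P m) ⊠ u ^ m) n

  eval-cong : ∀ {k} (us : Vec (PS R 1) k) {P Q : PS R k} → P ≋ Q → eval us P ≋ eval us Q
  eval-cong []       P≋Q (n ∷ []) = *-congʳ (P≋Q [])
  eval-cong (u ∷ us) P≋Q (n ∷ []) =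
    ∑-cong n (λ m _ → ⊠-cong (eval-cong us (λ e → P≋Q (m ∷ e))) (≋-refl {X = u ^ m}) (n ∷ []))

  eval-𝟘 : ∀ {k} (us : Vec (PS R 1) k) → eval us 𝟘 ≋ 𝟘
  eval-𝟘 []       (n ∷ []) = zeroˡ _
  eval-𝟘 (u ∷ us) (n ∷ []) =
    ∑-≈0 n (λ m _ → trans (⊠-cong (eval-𝟘 us) (≋-refl {X = u ^ m}) (n ∷ [])) (⊠-zeroˡ (u ^ m) (n ∷ [])))

  eval-⊞ : ∀ {k} (us : Vec (PS R 1) k) (P Q : PS R k) → eval us (P ⊞ Q) ≋ eval us P ⊞ eval us Q
  eval-⊞ []       P Q (n ∷ []) = distribʳ _ _ _
  eval-⊞ (u ∷ us) P Q (n ∷ []) = trans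
    (∑-cong n (λ m _ → trans (⊠-cong (eval-⊞ us (slice P m) (slice Q m)) (≋-refl {X = u ^ m}) (n ∷ []))
                             (⊠-distribʳ-⊞ (eval us (slice P m)) (eval us (slice Q m)) (u ^ m) (n ∷ []))))
    (∑-distrib-+ n _ _)

  eval-· : ∀ {k} (us : Vec (PS R 1) k) a (P : PS R k) → eval us (a · P) ≋ a · eval us P
  eval-· []       a P (n ∷ []) = *-assoc _ _ _
  eval-· (u ∷ us) a P (n ∷ []) = trans
    (∑-cong n (λ m _ → trans (⊠-cong (eval-· us a (slice P m)) (≋-refl {X = u ^ m}) (n ∷ []))
                             (·-⊠ a (eval us (slice P m)) (u ^ m) (n ∷ []))))
    (sym (*-distribˡ-∑ n a _))

  eval-∑ₚ : ∀ {k} (us : Vec (PS R 1) k) n (F : ℕ → PS R k) → eval us (∑ₚ n F) ≋ ∑ₚ[ i ≤ n ] eval us (F i)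
  eval-∑ₚ us zero    F = ≋-refl
  eval-∑ₚ us (suc n) F = ≋-trans (eval-⊞ us (∑ₚ n F) (F (suc n))) (λ e → +-congʳ (eval-∑ₚ us n F e))

  eval-∷-single : ∀ {k} {u} (us : Vec (PS R 1) k) {P : PS R (suc k)} j → NoConstantTerm u →
    (∀ m → m ≢ j → slice P m ≋ 𝟘) → eval (u ∷ us) P ≋ eval us (slice P j) ⊠ u ^ j
  eval-∷-single {u = u} us {P} j u₀ others (n ∷ []) = byCases (j ≤? n)
    where
    term≈0 : ∀ m → m ≢ j → coeff (eval us (slice P m) ⊠ u ^ m) n ≈ 0#
    term≈0 m m≢j = trans (⊠-cong (≋-trans (eval-cong us (others m m≢j)) (eval-𝟘 us)) (≋-refl {X = u ^ m}) (n ∷ []))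
                         (⊠-zeroˡ (u ^ m) (n ∷ []))
    byCases : Dec (j ≤ n) → coeff (eval (u ∷ us) P) n ≈ coeff (eval us (slice P j) ⊠ u ^ j) n
    byCases (yes j≤n) = ∑-single n j j≤n (λ m _ m≢j → term≈0 m m≢j)
    byCases (no  j≰n) = trans (∑-≈0 n (λ m m≤n → term≈0 m (λ { ≡.refl → j≰n m≤n })))
                              (sym (coeff-hasOrder≥ {X = eval us (slice P j) ⊠ u ^ j}
                                     (⊠-hasOrder≥ʳ (^-hasOrder≥ u₀ j)) (ℕₚ.≰⇒> j≰n)))

  eval-𝟙 : ∀ {k} (us : Vec (PS R 1) k) → All NoConstantTerm us → eval us 𝟙 ≋ 𝟙
  eval-𝟙 []       []          (n ∷ []) = *-identityˡ _
  eval-𝟙 (u ∷ us) (u₀ ∷ us₀) = begin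
    eval (u ∷ us) 𝟙 ≈⟨ eval-∷-single us 0 u₀ higher-slices ⟩
    eval us 𝟙 ⊠ 𝟙   ≈⟨ ⊠-identityʳ (eval us 𝟙) ⟩
    eval us 𝟙       ≈⟨ eval-𝟙 us us₀ ⟩
    𝟙               ∎
    where
    open ≋-Reasoning
    higher-slices : ∀ m → m ≢ 0 → slice 𝟙 m ≋ 𝟘
    higher-slices zero    0≢0 = ⊥-elim (0≢0 ≡.refl)
    higher-slices (suc m) _   = ≋-refl

  eval-var-zero : ∀ {k} {u} (us : Vec (PS R 1) k) → All NoConstantTerm (u ∷ us) → eval (u ∷ us) (var R fzero) ≋ u
  eval-var-zero {u = u} us (u₀ ∷ us₀) = begin
    eval (u ∷ us) (var R fzero) ≈⟨ eval-∷-single us 1 u₀ other-slices ⟩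
    eval us 𝟙 ⊠ (u ⊠ 𝟙)         ≈⟨ ⊠-cong (eval-𝟙 us us₀) (⊠-identityʳ u) ⟩
    𝟙 ⊠ u                       ≈⟨ ⊠-identityˡ u ⟩
    u                           ∎
    where
    open ≋-Reasoning
    other-slices : ∀ m → m ≢ 1 → slice (var R fzero) m ≋ 𝟘
    other-slices zero          _   = ≋-refl
    other-slices (suc zero)    1≢1 = ⊥-elim (1≢1 ≡.refl)
    other-slices (suc (suc m)) _   = ≋-refl

  eval-var-suc : ∀ {k} {u} (us : Vec (PS R 1) k) → NoConstantTerm u → (i : Fin k) →
    eval (u ∷ us) (var R (fsuc i)) ≋ eval us (var R i)
  eval-var-suc {u = u} us u₀ i = begin
    eval (u ∷ us) (var R (fsuc i))         ≈⟨ eval-∷-single us 0 u₀ higher-slices ⟩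
    eval us (slice (var R (fsuc i)) 0) ⊠ 𝟙 ≈⟨ ⊠-identityʳ _ ⟩
    eval us (slice (var R (fsuc i)) 0)     ≈⟨ eval-cong us (slice-var-suc i) ⟩
    eval us (var R i)                      ∎
    where
    open ≋-Reasoning
    higher-slices : ∀ m → m ≢ 0 → slice (var R (fsuc i)) m ≋ 𝟘
    higher-slices zero    0≢0 = ⊥-elim (0≢0 ≡.refl)
    higher-slices (suc m) _   = ≋-refl

  eval-∷-coeff : ∀ {k} {u} (us : Vec (PS R 1) k) → NoConstantTerm u → (P : PS R (suc k)) → ∀ {d n} → d ≤ n →
    coeff (eval (u ∷ us) P) d ≈ coeff (∑ₚ[ m ≤ n ] (eval us (slice P m) ⊠ u ^ m)) d
  eval-∷-coeff {u = u} us u₀ P d≤n = sym (∑-truncate _ d≤n (λ m d<m _ →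
    coeff-hasOrder≥ {X = eval us (slice P m) ⊠ u ^ m} (⊠-hasOrder≥ʳ (^-hasOrder≥ u₀ m)) d<m))

  eval-⊠ : ∀ {k} (us : Vec (PS R 1) k) → All NoConstantTerm us → (P Q : PS R k) →
    eval us (P ⊠ Q) ≋ eval us P ⊠ eval us Q
  eval-⊠ [] [] P Q = begin
    (P [] * Q []) · 𝟙               ≈⟨ (λ e → *-assoc _ _ _) ⟩
    P [] · (Q [] · 𝟙)               ≈⟨ ·-cong (P []) (·-cong (Q []) (⊠-identityˡ 𝟙)) ⟨
    P [] · (Q [] · (𝟙 ⊠ 𝟙))         ≈⟨ ·-cong (P []) (⊠-· (Q []) 𝟙 𝟙) ⟨
    P [] · (𝟙 ⊠ (Q [] · 𝟙))         ≈⟨ ·-⊠ (P []) 𝟙 (Q [] · 𝟙) ⟨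
    (P [] · 𝟙) ⊠ (Q [] · 𝟙)         ∎
    where open ≋-Reasoning
  eval-⊠ (u ∷ us) (u₀ ∷ us₀) P Q (n ∷ []) = begin
    ∑[ m ≤ n ] coeff (eval us (slice (P ⊠ Q) m) ⊠ u ^ m) n ≈⟨ ∑-cong n (λ m _ → slice-term m) ⟩
    ∑[ m ≤ n ] ∑[ i ≤ m ] h i (m ∸ i)                      ≈⟨ ∑-antidiagonals n h ⟩
    ∑[ i ≤ n ] ∑ (n ∸ i) (h i)                             ≈⟨ ∑-cong n (λ i _ → ∑-truncate n (ℕₚ.m∸n≤m n i)
                                                                (λ j n∸i<j _ → h≈0 i j n∸i<j)) ⟨
    ∑[ i ≤ n ] ∑ n (h i)                                   ≈⟨ product-coeff ⟨
    coeff (eval (u ∷ us) P ⊠ eval (u ∷ us) Q) n            ∎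
    where
    open ≈-Reasoning
    a b p q : ℕ → PS R 1
    a i = eval us (slice P i)
    b j = eval us (slice Q j)
    p i = a i ⊠ u ^ i
    q j = b j ⊠ u ^ j

    h : ℕ → ℕ → Carrier
    h i j = coeff (p i ⊠ q j) n

    h≈0 : ∀ i j → n ∸ i < j → h i j ≈ 0#
    h≈0 i j n∸i<j = coeff-hasOrder≥ {X = p i ⊠ q j}
      (⊠-hasOrder≥ (⊠-hasOrder≥ʳ (^-hasOrder≥ u₀ i)) (⊠-hasOrder≥ʳ (^-hasOrder≥ u₀ j)))
      (ℕₚ.≤-<-trans (ℕₚ.m≤n+m∸n n i) (ℕₚ.+-monoʳ-< i n∸i<j))

    regroup : ∀ m i → i ≤ m → (a i ⊠ b (m ∸ i)) ⊠ u ^ m ≋ p i ⊠ q (m ∸ i)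
    regroup m i i≤m = ≋-trans
      (⊠-cong ≋-refl (≋-trans (≡⇒≋ (≡.cong (u ^_) (≡.sym (ℕₚ.m+[n∸m]≡n i≤m)))) (^-+ u i (m ∸ i))))
      (⊠-interchange (a i) (b (m ∸ i)) (u ^ i) (u ^ (m ∸ i)))

    -- slice (P ⊠ Q) m is ∑ₚ[ i ≤ m ] (slice P i ⊠ slice Q (m ∸ i)) by definition of ⊠.
    slice-term : ∀ m → coeff (eval us (slice (P ⊠ Q) m) ⊠ u ^ m) n ≈ ∑[ i ≤ m ] h i (m ∸ i)
    slice-term m = begin
      coeff (eval us (∑ₚ[ i ≤ m ] (slice P i ⊠ slice Q (m ∸ i))) ⊠ u ^ m) n
        ≈⟨ ⊠-cong (≋-trans (eval-∑ₚ us m _) (∑ₚ-cong m (λ i _ → eval-⊠ us us₀ (slice P i) (slice Q (m ∸ i)))))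
                  (≋-refl {X = u ^ m}) (n ∷ []) ⟩
      coeff (∑ₚ[ i ≤ m ] (a i ⊠ b (m ∸ i)) ⊠ u ^ m) n
        ≈⟨ ⊠-distribʳ-∑ₚ m (λ i → a i ⊠ b (m ∸ i)) (u ^ m) (n ∷ []) ⟩
      ∑[ i ≤ m ] coeff ((a i ⊠ b (m ∸ i)) ⊠ u ^ m) n
        ≈⟨ ∑-cong m (λ i i≤m → regroup m i i≤m (n ∷ [])) ⟩
      ∑[ i ≤ m ] h i (m ∸ i) ∎

    product-coeff : coeff (eval (u ∷ us) P ⊠ eval (u ∷ us) Q) n ≈ ∑[ i ≤ n ] ∑ n (h i)
    product-coeff = begin
      coeff (eval (u ∷ us) P ⊠ eval (u ∷ us) Q) n
        ≈⟨ coeff-⊠-cong n {eval (u ∷ us) P} {∑ₚ n p} {eval (u ∷ us) Q} {∑ₚ n q}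
             (λ d d≤n → eval-∷-coeff us u₀ P d≤n) (λ d d≤n → eval-∷-coeff us u₀ Q d≤n) ⟩
      coeff (∑ₚ n p ⊠ ∑ₚ n q) n
        ≈⟨ ⊠-distribʳ-∑ₚ n p (∑ₚ n q) (n ∷ []) ⟩
      ∑[ i ≤ n ] coeff (p i ⊠ ∑ₚ n q) n
        ≈⟨ ∑-cong n (λ i _ → ⊠-distribˡ-∑ₚ n q (p i) (n ∷ [])) ⟩
      ∑[ i ≤ n ] ∑ n (h i) ∎

  eval-^ : ∀ {k} (us : Vec (PS R 1) k) → All NoConstantTerm us → (A : PS R k) → ∀ i → eval us (A ^ i) ≋ eval us A ^ i
  eval-^ us us₀ A zero    = eval-𝟙 us us₀
  eval-^ us us₀ A (suc i) = ≋-trans (eval-⊠ us us₀ A (A ^ i)) (⊠-cong ≋-refl (eval-^ us us₀ A i))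

  eval-coeff-cong : ∀ {k} (us : Vec (PS R 1) k) → All NoConstantTerm us → ∀ n {P Q : PS R k} →
    (∀ e → degree R e ≤ n → P e ≈ Q e) → coeff (eval us P) n ≈ coeff (eval us Q) n
  eval-coeff-cong []       []          n P≈Q = *-congʳ (P≈Q [] z≤n)
  eval-coeff-cong (u ∷ us) (u₀ ∷ us₀) n {P} {Q} P≈Q =
    ∑-cong n (λ m _ → ∑-cong n (λ d d≤n → summand m d d≤n (m ≤? n ∸ d)))
    where
    summand : ∀ m d → d ≤ n → Dec (m ≤ n ∸ d) →
      coeff (eval us (slice P m)) d * coeff (u ^ m) (n ∸ d) ≈ coeff (eval us (slice Q m)) d * coeff (u ^ m) (n ∸ d)
    summand m d d≤n (yes m≤n∸d) = *-congʳ (eval-coeff-cong us us₀ d (λ e deg≤d → P≈Q (m ∷ e) (begin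
      m ℕ.+ degree R e ≤⟨ ℕₚ.+-monoʳ-≤ m deg≤d ⟩
      m ℕ.+ d          ≤⟨ ℕₚ.+-monoˡ-≤ d m≤n∸d ⟩
      n ∸ d ℕ.+ d      ≡⟨ ℕₚ.m∸n+n≡m d≤n ⟩
      n                ∎)))
      where open ℕₚ.≤-Reasoning
    summand m d d≤n (no m≰n∸d) = trans (*-congˡ uᵐ≈0) (trans (zeroʳ _) (sym (trans (*-congˡ uᵐ≈0) (zeroʳ _))))
      where uᵐ≈0 = coeff-hasOrder≥ (^-hasOrder≥ u₀ m) (ℕₚ.≰⇒> m≰n∸d)

  -- Substitution into a series in two variables

  coeff₂ : PS R 2 → ℕ → ℕ → Carrier
  coeff₂ F i j = F (i ∷ j ∷ [])

  -- subst₂ R F A B e is subst₂≤ F A B (degree R e) e by definition.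
  subst₂≤ : ∀ {k} → PS R 2 → PS R k → PS R k → ℕ → PS R k
  subst₂≤ F A B M = ∑ₚ[ i ≤ M ] ∑ₚ[ j ≤ M ] (coeff₂ F i j · (A ^ i ⊠ B ^ j))

  subst₂-cong : ∀ {k} F {A A′ B B′ : PS R k} → A ≋ A′ → B ≋ B′ → subst₂ R F A B ≋ subst₂ R F A′ B′
  subst₂-cong F A≋A′ B≋B′ e =
    ∑-cong (degree R e) (λ i _ → ∑-cong (degree R e) (λ j _ → *-congˡ (⊠-cong (^-cong A≋A′ i) (^-cong B≋B′ j) e)))

  subst₂≈subst₂≤ : ∀ {k} F {A B : PS R k} → NoConstantTerm A → NoConstantTerm B →
    ∀ {M} e → degree R e ≤ M → subst₂ R F A B e ≈ subst₂≤ F A B M e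
  subst₂≈subst₂≤ F A₀ B₀ e deg≤M = sym (∑²-truncate _ _ deg≤M (λ i j deg<i+j →
    trans (*-congˡ (⊠-hasOrder≥ (^-hasOrder≥ A₀ i) (^-hasOrder≥ B₀ j) e deg<i+j)) (zeroʳ _)))

  subst₂-noConstantTerm : ∀ {k} F {A B : PS R k} → coeff₂ F 0 0 ≈ 0# →
    NoConstantTerm A → NoConstantTerm B → NoConstantTerm (subst₂ R F A B)
  subst₂-noConstantTerm F F₀₀≈0 A₀ B₀ e (s≤s deg≤0) =
    trans (subst₂≈subst₂≤ F A₀ B₀ e deg≤0) (trans (*-congʳ F₀₀≈0) (zeroˡ _))

  eval-subst₂≤ : ∀ {k} (us : Vec (PS R 1) k) → All NoConstantTerm us → ∀ F (A B : PS R k) M →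
    eval us (subst₂≤ F A B M) ≋ subst₂≤ F (eval us A) (eval us B) M
  eval-subst₂≤ us us₀ F A B M = begin
    eval us (∑ₚ[ i ≤ M ] ∑ₚ[ j ≤ M ] (coeff₂ F i j · (A ^ i ⊠ B ^ j)))
      ≈⟨ eval-∑ₚ us M _ ⟩
    ∑ₚ[ i ≤ M ] eval us (∑ₚ[ j ≤ M ] (coeff₂ F i j · (A ^ i ⊠ B ^ j)))
      ≈⟨ ∑ₚ-cong M (λ i _ → eval-∑ₚ us M _) ⟩
    ∑ₚ[ i ≤ M ] ∑ₚ[ j ≤ M ] eval us (coeff₂ F i j · (A ^ i ⊠ B ^ j))
      ≈⟨ ∑ₚ-cong M (λ i _ → ∑ₚ-cong M (λ j _ → eval-· us (coeff₂ F i j) (A ^ i ⊠ B ^ j))) ⟩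
    ∑ₚ[ i ≤ M ] ∑ₚ[ j ≤ M ] (coeff₂ F i j · eval us (A ^ i ⊠ B ^ j))
      ≈⟨ ∑ₚ-cong M (λ i _ → ∑ₚ-cong M (λ j _ → ·-cong (coeff₂ F i j)
           (≋-trans (eval-⊠ us us₀ (A ^ i) (B ^ j)) (⊠-cong (eval-^ us us₀ A i) (eval-^ us us₀ B j))))) ⟩
    ∑ₚ[ i ≤ M ] ∑ₚ[ j ≤ M ] (coeff₂ F i j · (eval us A ^ i ⊠ eval us B ^ j)) ∎
    where open ≋-Reasoning

  eval-subst₂ : ∀ {k} (us : Vec (PS R 1) k) → All NoConstantTerm us → ∀ F {P Q : PS R k} {A B} →
    NoConstantTerm P → NoConstantTerm Q → eval us P ≋ A → eval us Q ≋ B → eval us (subst₂ R F P Q) ≋ subst₂ R F A B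
  eval-subst₂ us us₀ F {P} {Q} P₀ Q₀ P↦A Q↦B = ≋-trans commutes (subst₂-cong F P↦A Q↦B)
    where
    commutes : eval us (subst₂ R F P Q) ≋ subst₂ R F (eval us P) (eval us Q)
    commutes (n ∷ []) = trans
      (eval-coeff-cong us us₀ n (λ e deg≤n → subst₂≈subst₂≤ F P₀ Q₀ e (ℕₚ.≤-trans deg≤n (ℕₚ.m≤m+n n 0))))
      (eval-subst₂≤ us us₀ F P Q (n ℕ.+ 0) (n ∷ []))

  monomialCoeff : PS R 2 → PS R 1 → PS R 1 → ℕ → ℕ → ℕ → Carrier
  monomialCoeff F A B n i j = coeff₂ F i j * coeff (A ^ i ⊠ B ^ j) n

  coeff-subst₂ : ∀ F {A B : PS R 1} → NoConstantTerm A → NoConstantTerm B → ∀ n →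
    coeff (subst₂ R F A B) n ≈ ∑[ i ≤ suc n ] ∑ (suc n) (monomialCoeff F A B n i)
  coeff-subst₂ F A₀ B₀ n =
    subst₂≈subst₂≤ F A₀ B₀ (n ∷ []) (ℕₚ.m≤n⇒m≤1+n (ℕₚ.≤-reflexive (ℕₚ.+-identityʳ n)))

  -- F(x, y) = F(x, 0) + F(0, y) − F(0, 0) + x y · (divXY F)(x, y)
  divXY : PS R 2 → PS R 2
  divXY F (i ∷ j ∷ []) = F (suc i ∷ suc j ∷ [])

  coeff-⊠-subst₂-divXY : ∀ F {A B : PS R 1} → NoConstantTerm A → NoConstantTerm B → ∀ n →
    coeff ((A ⊠ B) ⊠ subst₂ R (divXY F) A B) n ≈ ∑[ i ≤ n ] ∑[ j ≤ n ] monomialCoeff F A B n (suc i) (suc j)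
  coeff-⊠-subst₂-divXY F {A} {B} A₀ B₀ n = begin
    coeff ((A ⊠ B) ⊠ subst₂ R G A B) n
      ≈⟨ coeff-⊠-cong n {A ⊠ B} {A ⊠ B} {subst₂ R G A B} {subst₂≤ G A B n} (λ _ _ → refl) (λ d d≤n →
           subst₂≈subst₂≤ G A₀ B₀ (d ∷ []) (ℕₚ.≤-trans (ℕₚ.≤-reflexive (ℕₚ.+-identityʳ d)) d≤n)) ⟩
    coeff ((A ⊠ B) ⊠ subst₂≤ G A B n) n
      ≈⟨ ⊠-distribˡ-∑ₚ n (λ i → ∑ₚ[ j ≤ n ] (coeff₂ G i j · (A ^ i ⊠ B ^ j))) (A ⊠ B) (n ∷ []) ⟩
    ∑[ i ≤ n ] coeff ((A ⊠ B) ⊠ ∑ₚ[ j ≤ n ] (coeff₂ G i j · (A ^ i ⊠ B ^ j))) n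
      ≈⟨ ∑-cong n (λ i _ → ⊠-distribˡ-∑ₚ n (λ j → coeff₂ G i j · (A ^ i ⊠ B ^ j)) (A ⊠ B) (n ∷ [])) ⟩
    ∑[ i ≤ n ] ∑[ j ≤ n ] coeff ((A ⊠ B) ⊠ (coeff₂ G i j · (A ^ i ⊠ B ^ j))) n
      ≈⟨ ∑-cong n (λ i _ → ∑-cong n (λ j _ → trans (⊠-· (coeff₂ G i j) (A ⊠ B) (A ^ i ⊠ B ^ j) (n ∷ []))
           (*-congˡ (⊠-interchange A B (A ^ i) (B ^ j) (n ∷ []))))) ⟩
    ∑[ i ≤ n ] ∑[ j ≤ n ] monomialCoeff F A B n (suc i) (suc j) ∎
    where
    open ≈-Reasoning
    G = divXY F

  -- Formal group laws

  module _ (F : PS R 2) (isFGL : IsFGL R F) where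

    open IsFGL isFGL

    -- the constant coefficient of F(x, 0) = x
    F₀₀≈0 : coeff₂ F 0 0 ≈ 0#
    F₀₀≈0 = trans (sym (trans (*-congˡ (*-identityʳ 1#)) (*-identityʳ _))) (identityˡ (0 ∷ []))

    subst₂-identityʳ : ∀ {A : PS R 1} → NoConstantTerm A → subst₂ R F A 𝟘 ≋ A
    subst₂-identityʳ {A} A₀ = begin
      subst₂ R F A 𝟘                         ≈⟨ eval-subst₂ (A ∷ []) (A₀ ∷ []) F (var-noConstantTerm fzero)
                                                  𝟘-noConstantTerm (eval-var-zero [] (A₀ ∷ [])) (eval-𝟘 (A ∷ [])) ⟨
      eval (A ∷ []) (subst₂ R F (var R fzero) 𝟘) ≈⟨ eval-cong (A ∷ []) identityˡ ⟩
      eval (A ∷ []) (var R fzero)            ≈⟨ eval-var-zero [] (A₀ ∷ []) ⟩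
      A                                      ∎
      where open ≋-Reasoning

    subst₂-identityˡ : ∀ {B : PS R 1} → NoConstantTerm B → subst₂ R F 𝟘 B ≋ B
    subst₂-identityˡ {B} B₀ = begin
      subst₂ R F 𝟘 B                         ≈⟨ eval-subst₂ (B ∷ []) (B₀ ∷ []) F 𝟘-noConstantTerm
                                                  (var-noConstantTerm fzero) (eval-𝟘 (B ∷ [])) (eval-var-zero [] (B₀ ∷ [])) ⟨
      eval (B ∷ []) (subst₂ R F 𝟘 (var R fzero)) ≈⟨ eval-cong (B ∷ []) identityʳ ⟩
      eval (B ∷ []) (var R fzero)            ≈⟨ eval-var-zero [] (B₀ ∷ []) ⟩
      B                                      ∎
      where open ≋-Reasoning

    subst₂-assoc : ∀ {A B C : PS R 1} → NoConstantTerm A → NoConstantTerm B → NoConstantTerm C →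
      subst₂ R F (subst₂ R F A B) C ≋ subst₂ R F A (subst₂ R F B C)
    subst₂-assoc {A} {B} {C} A₀ B₀ C₀ = begin
      subst₂ R F (subst₂ R F A B) C    ≈⟨ eval-subst₂ us us₀ F (F-noConstantTerm x₀ y₀) z₀
                                            (eval-subst₂ us us₀ F x₀ y₀ x↦A y↦B) z↦C ⟨
      eval us (subst₂ R F (subst₂ R F x y) z) ≈⟨ eval-cong us assoc ⟩
      eval us (subst₂ R F x (subst₂ R F y z)) ≈⟨ eval-subst₂ us us₀ F x₀ (F-noConstantTerm y₀ z₀)
                                                   x↦A (eval-subst₂ us us₀ F y₀ z₀ y↦B z↦C) ⟩
      subst₂ R F A (subst₂ R F B C)    ∎
      where
      open ≋-Reasoning
      F-noConstantTerm : ∀ {k} {P Q : PS R k} → NoConstantTerm P → NoConstantTerm Q → NoConstantTerm (subst₂ R F P Q)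
      F-noConstantTerm = subst₂-noConstantTerm F F₀₀≈0
      us = A ∷ B ∷ C ∷ []
      us₀ : All NoConstantTerm us
      us₀ = A₀ ∷ B₀ ∷ C₀ ∷ []
      x y z : PS R 3
      x = var R fzero
      y = var R (fsuc fzero)
      z = var R (fsuc (fsuc fzero))
      x₀ = var-noConstantTerm fzero
      y₀ = var-noConstantTerm (fsuc fzero)
      z₀ = var-noConstantTerm (fsuc (fsuc fzero))
      x↦A : eval us x ≋ A
      x↦A = eval-var-zero (B ∷ C ∷ []) us₀
      y↦B : eval us y ≋ B
      y↦B = ≋-trans (eval-var-suc (B ∷ C ∷ []) A₀ fzero) (eval-var-zero (C ∷ []) (B₀ ∷ C₀ ∷ []))
      z↦C : eval us z ≋ C
      z↦C = ≋-trans (eval-var-suc (B ∷ C ∷ []) A₀ (fsuc fzero))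
                    (≋-trans (eval-var-suc (C ∷ []) B₀ fzero) (eval-var-zero [] (C₀ ∷ [])))

    nSeries-noConstantTerm : ∀ n → NoConstantTerm (nSeries R F n)
    nSeries-noConstantTerm zero    = 𝟘-noConstantTerm
    nSeries-noConstantTerm (suc n) =
      subst₂-noConstantTerm F F₀₀≈0 (nSeries-noConstantTerm n) (var-noConstantTerm fzero)

    nSeries-+ : ∀ a b → nSeries R F (a ℕ.+ b) ≋ subst₂ R F (nSeries R F a) (nSeries R F b)
    nSeries-+ a zero = begin
      nSeries R F (a ℕ.+ 0)          ≡⟨ ≡.cong (nSeries R F) (ℕₚ.+-identityʳ a) ⟩
      nSeries R F a                  ≈⟨ subst₂-identityʳ (nSeries-noConstantTerm a) ⟨
      subst₂ R F (nSeries R F a) 𝟘   ∎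
      where open ≋-Reasoning
    nSeries-+ a (suc b) = begin
      nSeries R F (a ℕ.+ suc b)                                   ≡⟨ ≡.cong (nSeries R F) (ℕₚ.+-suc a b) ⟩
      subst₂ R F (nSeries R F (a ℕ.+ b)) t                        ≈⟨ subst₂-cong F (nSeries-+ a b) ≋-refl ⟩
      subst₂ R F (subst₂ R F (nSeries R F a) (nSeries R F b)) t   ≈⟨ subst₂-assoc (nSeries-noConstantTerm a)
                                                                       (nSeries-noConstantTerm b) (var-noConstantTerm fzero) ⟩
      subst₂ R F (nSeries R F a) (subst₂ R F (nSeries R F b) t)   ∎
      where
      open ≋-Reasoning
      t = var R fzero

    coeff-subst₂-split : ∀ {A B : PS R 1} → NoConstantTerm A → NoConstantTerm B → ∀ n →
      coeff (subst₂ R F A B) n ≈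
        (∑[ i ≤ n ] monomialCoeff F A B n (suc i) 0 + ∑[ j ≤ n ] monomialCoeff F A B n 0 (suc j))
          + ∑[ i ≤ n ] ∑[ j ≤ n ] monomialCoeff F A B n (suc i) (suc j)
    coeff-subst₂-split {A} {B} A₀ B₀ n = begin
      coeff (subst₂ R F A B) n
        ≈⟨ coeff-subst₂ F A₀ B₀ n ⟩
      ∑[ i ≤ suc n ] ∑ (suc n) (t i)
        ≈⟨ ∑²-split n t ⟩
      ((t 0 0 + ∑[ j ≤ n ] t 0 (suc j)) + ∑[ i ≤ n ] t (suc i) 0) + ∑[ i ≤ n ] ∑[ j ≤ n ] t (suc i) (suc j)
        ≈⟨ +-congʳ (+-congʳ (+-congʳ (trans (*-congʳ F₀₀≈0) (zeroˡ _)))) ⟩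
      ((0# + ∑[ j ≤ n ] t 0 (suc j)) + ∑[ i ≤ n ] t (suc i) 0) + ∑[ i ≤ n ] ∑[ j ≤ n ] t (suc i) (suc j)
        ≈⟨ +-congʳ (trans (+-congʳ (+-identityˡ _)) (+-comm _ _)) ⟩
      (∑[ i ≤ n ] t (suc i) 0 + ∑[ j ≤ n ] t 0 (suc j)) + ∑[ i ≤ n ] ∑[ j ≤ n ] t (suc i) (suc j) ∎
      where
      open ≈-Reasoning
      t = monomialCoeff F A B n

    -- 𝟘 ^ 0 and B ^ 0 are both 𝟙, so the sum is also ∑[ i ≤ n ] monomialCoeff F A B n (suc i) 0 for any B.
    coeff-axisˡ : ∀ {A : PS R 1} → NoConstantTerm A → ∀ n → coeff A n ≈ ∑[ i ≤ n ] monomialCoeff F A 𝟘 n (suc i) 0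
    coeff-axisˡ {A} A₀ n = begin
      coeff A n                ≈⟨ subst₂-identityʳ A₀ (n ∷ []) ⟨
      coeff (subst₂ R F A 𝟘) n ≈⟨ coeff-subst₂-split A₀ 𝟘-noConstantTerm n ⟩
      (S + ∑[ j ≤ n ] t 0 (suc j)) + ∑[ i ≤ n ] ∑[ j ≤ n ] t (suc i) (suc j)
        ≈⟨ +-cong (+-congˡ (∑-≈0 n (λ j _ → t≈0 0 j))) (∑-≈0 n (λ i _ → ∑-≈0 n (λ j _ → t≈0 (suc i) j))) ⟩
      (S + 0#) + 0#            ≈⟨ trans (+-identityʳ _) (+-identityʳ _) ⟩
      S                        ∎
      where
      open ≈-Reasoning
      t = monomialCoeff F A 𝟘 n
      S = ∑[ i ≤ n ] t (suc i) 0
      t≈0 : ∀ i j → t i (suc j) ≈ 0#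
      t≈0 i j = trans (*-congˡ (trans (⊠-cong (≋-refl {X = A ^ i}) (⊠-zeroˡ (𝟘 ^ j)) (n ∷ []))
                                      (⊠-zeroʳ (A ^ i) (n ∷ []))))
                      (zeroʳ _)

    coeff-axisʳ : ∀ {B : PS R 1} → NoConstantTerm B → ∀ n → coeff B n ≈ ∑[ j ≤ n ] monomialCoeff F 𝟘 B n 0 (suc j)
    coeff-axisʳ {B} B₀ n = begin
      coeff B n                ≈⟨ subst₂-identityˡ B₀ (n ∷ []) ⟨
      coeff (subst₂ R F 𝟘 B) n ≈⟨ coeff-subst₂-split 𝟘-noConstantTerm B₀ n ⟩
      (∑[ i ≤ n ] t (suc i) 0 + S) + ∑[ i ≤ n ] ∑[ j ≤ n ] t (suc i) (suc j)
        ≈⟨ +-cong (+-congʳ (∑-≈0 n (λ i _ → t≈0 i 0))) (∑-≈0 n (λ i _ → ∑-≈0 n (λ j _ → t≈0 i (suc j)))) ⟩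
      (0# + S) + 0#            ≈⟨ trans (+-identityʳ _) (+-identityˡ _) ⟩
      S                        ∎
      where
      open ≈-Reasoning
      t = monomialCoeff F 𝟘 B n
      S = ∑[ j ≤ n ] t 0 (suc j)
      t≈0 : ∀ i j → t (suc i) j ≈ 0#
      t≈0 i j = trans (*-congˡ (trans (⊠-cong (⊠-zeroˡ (𝟘 ^ i)) (≋-refl {X = B ^ j}) (n ∷ []))
                                      (⊠-zeroˡ (B ^ j) (n ∷ []))))
                      (zeroʳ _)

    subst₂-expand : ∀ {A B : PS R 1} → NoConstantTerm A → NoConstantTerm B →
      subst₂ R F A B ≋ (A ⊞ B) ⊞ (A ⊠ B) ⊠ subst₂ R (divXY F) A B
    subst₂-expand {A} {B} A₀ B₀ (n ∷ []) = begin
      coeff (subst₂ R F A B) n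
        ≈⟨ coeff-subst₂-split A₀ B₀ n ⟩
      (∑[ i ≤ n ] monomialCoeff F A B n (suc i) 0 + ∑[ j ≤ n ] monomialCoeff F A B n 0 (suc j))
        + ∑[ i ≤ n ] ∑[ j ≤ n ] monomialCoeff F A B n (suc i) (suc j)
        ≈⟨ +-cong (+-cong (coeff-axisˡ A₀ n) (coeff-axisʳ B₀ n)) (coeff-⊠-subst₂-divXY F A₀ B₀ n) ⟨
      (coeff A n + coeff B n) + coeff ((A ⊠ B) ⊠ subst₂ R (divXY F) A B) n ∎
      where open ≈-Reasoning

open import Data.Nat using (_+_; _>_)

-- The non-zero-divisor hypothesis is what makes n ↦ [n]_F(t) a generalized n-series;
-- the congruence holds for every formal group law.
mainTheorem8 : ∀ {c ℓ} (R : CommutativeRing c ℓ) (F : PS R 2) → IsFGL R F →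
    (∀ (n : ℕ) → n > 0 → NonZeroDivisor R (nSeries R F n)) →
    ∀ (a b : ℕ) →
      CongMod R (nSeries R F (a + b))
                (_+ₚ_ R (nSeries R F a) (nSeries R F b))
                (_*ₚ_ R (nSeries R F a) (nSeries R F b))
mainTheorem8 R F isFGL _ a b =
  subst₂ R (divXY R F) (nSeries R F a) (nSeries R F b) ,
  ≋-trans R (nSeries-+ R F isFGL a b)
            (subst₂-expand R F isFGL (nSeries-noConstantTerm R F isFGL a) (nSeries-noConstantTerm R F isFGL b))
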